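{- (Provable in $\mathsf{RCA}_0$.) Fix some $k \in \mathbb{N}$. For every coloring $f : [\mathbb{N}]^2 \to 2$ which is transitive for color 0, and such that there is no $f$-homogeneous set for color 1 of size $k$, there is a coloring $g : \mathbb{N} \to \binom{k+1}{2}$ such that for every $i < \binom{k+1}{2}$, $g^{ -1}(i)$ is $f$-homogeneous for color 0.
   Context: A coloring $f : [\mathbb{N}]^2 \to 2$ is transitive for color $i$ if for all $x<y<z$ with $f(x,y)=f(y,z)=i$ we have $f(x,z)=i$. A set $H$ is $f$-homogeneous for color $i$ if $f(x,y)=i$ for all distinct $x,y \in H$. -}

module Defs where

open import Data.Nat using (ℕ; _<_)
open import Data.Fin using (Fin)
open import Relation.Binary.PropositionalEquality using (_≡_)
open import Relation.Nullary using (¬_)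
open import Data.Product using (Σ; _×_)

-- A coloring of [ℕ]² with 2 colors: f x y is the color of {x,y}, read only for x < y.
Coloring2 : Set
Coloring2 = ℕ → ℕ → Fin 2

TransitiveFor : Coloring2 → Fin 2 → Set
TransitiveFor f i = ∀ x y z → x < y → y < z → f x y ≡ i → f y z ≡ i → f x z ≡ i

HomogeneousFor : Coloring2 → Fin 2 → (ℕ → Set) → Set
HomogeneousFor f i S = ∀ x y → S x → S y → x < y → f x y ≡ i

-- A finite set of size k, given as a strictly increasing enumeration h : Fin k → ℕ
StrictlyIncreasing : {k : ℕ} → (Fin k → ℕ) → Set
StrictlyIncreasing {k} h = ∀ (a b : Fin k) → a Data.Fin.< b → h a < h b

Range : {k : ℕ} → (Fin k → ℕ) → ℕ → Set
Range {k} h x = Σ (Fin k) (λ a → h a ≡ x)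

HasHomogeneousOfSize : Coloring2 → Fin 2 → ℕ → Set
HasHomogeneousOfSize f i k =
  Σ (Fin k → ℕ) (λ h → StrictlyIncreasing h × HomogeneousFor f i (Range h))

{-# OPTIONS --safe #-}
-- Transitivity for colour 0 makes x ≺ y :⇔ x < y × f x y ≡ 0 a strict order in which every
-- number is maximal among the numbers before it, and colour-1 homogeneous sets are its
-- antichains. So it suffices to cover an order of width m by (m+2 choose 2) chains online,
-- choosing the chain of x from the order on 0, …, x alone.
--
-- Call x a top if it is the largest element of an antichain of size m among 0, …, x. The
-- other elements have width m - 1 and are covered recursively, which costs
-- m + (m+1 choose 2) ≤ (m+2 choose 2) chains in all. The tops go on m chains, keeping an
-- antichain A of size m matched injectively to chains whose last element lies below (≼) its
-- partner. When a top x arrives with its antichain B, the maximal elements of A ∪ B are again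
-- at least m many, since the minimal ones form an antichain and |A| + |B| ≤ |max| + |min|.
-- They satisfy Hall's condition: for a set X of them, the members of A below X are matched
-- into the neighbourhood of X, while the other members of A together with X form an
-- antichain. Hall's theorem rematches them, and x goes on the chain matched to it.

module Submission where

open import Defs
open import Data.Empty using (⊥-elim)
open import Data.Fin.Base as Fin using (Fin; zero; suc; toℕ; opposite; inject≤; _↑ˡ_; _↑ʳ_; splitAt)
import Data.Fin.Properties as Finₚ
open Finₚ using (_≟_; any?; decFinSubset; toℕ<n; toℕ-inject≤; inject≤-injective; opposite-prop;
                 ↑ˡ-injective; ↑ʳ-injective; splitAt-↑ˡ; splitAt-↑ʳ)
open import Data.Fin.Subset as Subset hiding (⊤; ⊥)
open import Data.Fin.Subset.Properties
open import Data.Fin.Subset.Induction using (⊂-wellFounded; Acc; acc)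
open import Data.Maybe.Base using (Maybe; just; nothing)
open import Data.Nat.Base using (ℕ; zero; suc; _+_; _∸_; _≤_; _<_; z≤n; s≤s)
open import Data.Nat.Combinatorics using (_C_; nC1≡n; nCk+nC[k+1]≡[n+1]C[k+1])
open import Data.Nat.Properties renaming (_≟_ to _≟ℕ_)
open import Data.Product as Product using (Σ; Σ-syntax; ∃; _×_; _,_; proj₁; proj₂)
open import Data.Sum using (_⊎_; inj₁; inj₂)
open import Data.Unit.Base using (⊤; tt)
open import Data.Vec.Base using ([]; _∷_; here; there)
open import Data.Vec.Functional using (Vector; updateAt)
open import Data.Vec.Functional.Properties using (updateAt-updates; updateAt-minimal)
open import Function using (_∘_; flip; const)
open import Level using (0ℓ)
open import Relation.Binary as B using (REL)
open import Relation.Binary.PropositionalEquality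
  using (_≡_; _≢_; refl; sym; trans; cong; subst; subst₂; module ≡-Reasoning)
open import Relation.Nullary using (Dec; does; yes; no; ¬_; _×-dec_; _⊎-dec_; ¬?)
open import Relation.Unary as U using (Pred)

private
  variable
    n r : ℕ
    p q : Subset n

≢0⇒≡1 : ∀ (c : Fin 2) → c ≢ zero → c ≡ suc zero
≢0⇒≡1 zero c≢0 = ⊥-elim (c≢0 refl)
≢0⇒≡1 (suc zero) _ = refl

<⇒opposite> : ∀ {i j : Fin n} → i Fin.< j → toℕ (opposite j) < toℕ (opposite i)
<⇒opposite> {n} {i} {j} i<j = begin-strict
  toℕ (opposite j)  ≡⟨ opposite-prop j ⟩
  n ∸ suc (toℕ j)   <⟨ ∸-monoʳ-< (s≤s i<j) (toℕ<n j) ⟩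
  n ∸ suc (toℕ i)   ≡⟨ opposite-prop i ⟨
  toℕ (opposite i)  ∎
  where open ≤-Reasoning

↑ˡ≢↑ʳ : ∀ {a b} {i : Fin a} {j : Fin b} → i ↑ˡ b ≢ a ↑ʳ j
↑ˡ≢↑ʳ {a} {b} {i} {j} eq with trans (sym (splitAt-↑ˡ a i b)) (trans (cong (splitAt a) eq) (splitAt-↑ʳ a b j))
... | ()

subsetOf : {P : Pred (Fin n) 0ℓ} → U.Decidable P → Subset n
subsetOf {zero} P? = []
subsetOf {suc n} P? = does (P? zero) ∷ subsetOf (P? ∘ suc)

∈-subsetOf⁻ : {P : Pred (Fin n) 0ℓ} (P? : U.Decidable P) {i : Fin n} → i ∈ subsetOf P? → P i
∈-subsetOf⁻ P? {zero} i∈ with P? zero | i∈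
... | yes Pi | _ = Pi
∈-subsetOf⁻ P? {suc i} (there i∈) = ∈-subsetOf⁻ (P? ∘ suc) i∈

∈-subsetOf⁺ : {P : Pred (Fin n) 0ℓ} (P? : U.Decidable P) {i : Fin n} → P i → i ∈ subsetOf P?
∈-subsetOf⁺ P? {zero} Pi with P? zero
... | yes _ = here
... | no ¬Pi = ⊥-elim (¬Pi Pi)
∈-subsetOf⁺ P? {suc i} Pi = there (∈-subsetOf⁺ (P? ∘ suc) Pi)

x∈p─q⇒x∉q : ∀ (p q : Subset n) {x} → x ∈ p ─ q → x ∉ q
x∈p─q⇒x∉q (inside ∷ p) (outside ∷ q) here ()
x∈p─q⇒x∉q (_ ∷ p) (_ ∷ q) (there x∈p─q) (there x∈q) = x∈p─q⇒x∉q p q x∈p─q x∈q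

0<∣p∣⇒Nonempty : ∀ (p : Subset n) → 0 < ∣ p ∣ → Nonempty p
0<∣p∣⇒Nonempty (inside ∷ p) _ = zero , here
0<∣p∣⇒Nonempty (outside ∷ p) 0<∣p∣ = Product.map suc there (0<∣p∣⇒Nonempty p 0<∣p∣)

Empty⇒∣p∣≡0 : ∀ {n} {p : Subset n} → Empty p → ∣ p ∣ ≡ 0
Empty⇒∣p∣≡0 {n = n} empty = trans (cong ∣_∣ (Empty-unique empty)) (∣⊥∣≡0 n)

∣p∪q∣+∣p∩q∣≡∣p∣+∣q∣ : ∀ (p q : Subset n) → ∣ p ∪ q ∣ + ∣ p ∩ q ∣ ≡ ∣ p ∣ + ∣ q ∣
∣p∪q∣+∣p∩q∣≡∣p∣+∣q∣ [] [] = refl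
∣p∪q∣+∣p∩q∣≡∣p∣+∣q∣ (inside ∷ p) (inside ∷ q) = cong suc (begin
  ∣ p ∪ q ∣ + suc ∣ p ∩ q ∣ ≡⟨ +-suc _ _ ⟩
  suc (∣ p ∪ q ∣ + ∣ p ∩ q ∣) ≡⟨ cong suc (∣p∪q∣+∣p∩q∣≡∣p∣+∣q∣ p q) ⟩
  suc (∣ p ∣ + ∣ q ∣) ≡⟨ +-suc _ _ ⟨
  ∣ p ∣ + suc ∣ q ∣ ∎)
  where open ≡-Reasoning
∣p∪q∣+∣p∩q∣≡∣p∣+∣q∣ (inside ∷ p) (outside ∷ q) = cong suc (∣p∪q∣+∣p∩q∣≡∣p∣+∣q∣ p q)
∣p∪q∣+∣p∩q∣≡∣p∣+∣q∣ (outside ∷ p) (inside ∷ q) = trans (cong suc (∣p∪q∣+∣p∩q∣≡∣p∣+∣q∣ p q)) (sym (+-suc _ _))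
∣p∪q∣+∣p∩q∣≡∣p∣+∣q∣ (outside ∷ p) (outside ∷ q) = ∣p∪q∣+∣p∩q∣≡∣p∣+∣q∣ p q

∣p∪q∣≤∣p∣+∣q∣ : ∀ (p q : Subset n) → ∣ p ∪ q ∣ ≤ ∣ p ∣ + ∣ q ∣
∣p∪q∣≤∣p∣+∣q∣ p q = subst (∣ p ∪ q ∣ ≤_) (∣p∪q∣+∣p∩q∣≡∣p∣+∣q∣ p q) (m≤m+n _ _)

Empty[p∩q]⇒∣p∪q∣≡∣p∣+∣q∣ : ∀ (p q : Subset n) → Empty (p ∩ q) → ∣ p ∪ q ∣ ≡ ∣ p ∣ + ∣ q ∣
Empty[p∩q]⇒∣p∪q∣≡∣p∣+∣q∣ p q disjoint = begin
  ∣ p ∪ q ∣               ≡⟨ +-identityʳ _ ⟨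
  ∣ p ∪ q ∣ + 0           ≡⟨ cong (∣ p ∪ q ∣ +_) (Empty⇒∣p∣≡0 disjoint) ⟨
  ∣ p ∪ q ∣ + ∣ p ∩ q ∣   ≡⟨ ∣p∪q∣+∣p∩q∣≡∣p∣+∣q∣ p q ⟩
  ∣ p ∣ + ∣ q ∣           ∎
  where open ≡-Reasoning

∣p∣≤∣p─q∣+∣q∣ : ∀ (p q : Subset n) → ∣ p ∣ ≤ ∣ p ─ q ∣ + ∣ q ∣
∣p∣≤∣p─q∣+∣q∣ p q = ≤-trans (p⊆q⇒∣p∣≤∣q∣ p⊆[p─q]∪q) (∣p∪q∣≤∣p∣+∣q∣ (p ─ q) q)
  where
  p⊆[p─q]∪q : p ⊆ (p ─ q) ∪ q
  p⊆[p─q]∪q {x} x∈p with x ∈? q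
  ... | yes x∈q = x∈p∪q⁺ (inj₂ x∈q)
  ... | no x∉q = x∈p∪q⁺ (inj₁ (x∈p∧x∉q⇒x∈p─q x∈p x∉q))

InjectiveOn : ∀ {A : Set} → (Fin n → A) → Subset n → Set
InjectiveOn κ p = ∀ {i j} → i ∈ p → j ∈ p → κ i ≡ κ j → i ≡ j

InjectiveOn-∷⁻ : ∀ {A : Set} {κ : Fin (suc n) → A} {s} → InjectiveOn κ (s ∷ p) → InjectiveOn (κ ∘ suc) p
InjectiveOn-∷⁻ injective i∈p j∈p eq = Finₚ.suc-injective (injective (there i∈p) (there j∈p) eq)

InjectiveOn⇒∣p∣≤∣q∣ : ∀ {p : Subset n} {q : Subset r} (κ : Fin n → Fin r) →
                      InjectiveOn κ p → (∀ {i} → i ∈ p → κ i ∈ q) → ∣ p ∣ ≤ ∣ q ∣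
InjectiveOn⇒∣p∣≤∣q∣ {p = []} _ _ _ = z≤n
InjectiveOn⇒∣p∣≤∣q∣ {p = outside ∷ p} κ injective into =
  InjectiveOn⇒∣p∣≤∣q∣ {p = p} (κ ∘ suc) (InjectiveOn-∷⁻ injective) (into ∘ there)
InjectiveOn⇒∣p∣≤∣q∣ {p = inside ∷ p} {q} κ injective into =
  ≤-trans (s≤s (InjectiveOn⇒∣p∣≤∣q∣ (κ ∘ suc) (InjectiveOn-∷⁻ injective) into[q-κ0]))
          (x∈p⇒∣p-x∣<∣p∣ (into here))
  where
  into[q-κ0] : ∀ {i} → i ∈ p → κ (suc i) ∈ q - κ zero
  into[q-κ0] i∈p = x∈p∧x≢y⇒x∈p-y (into (there i∈p)) (λ eq → Finₚ.0≢1+n (injective here (there i∈p) (sym eq)))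

members : (p : Subset n) → Fin ∣ p ∣ → Fin n
members (inside ∷ p) zero = zero
members (inside ∷ p) (suc i) = suc (members p i)
members (outside ∷ p) i = suc (members p i)

members-∈ : ∀ (p : Subset n) i → members p i ∈ p
members-∈ (inside ∷ p) zero = here
members-∈ (inside ∷ p) (suc i) = there (members-∈ p i)
members-∈ (outside ∷ p) i = there (members-∈ p i)

members-strictMono : ∀ (p : Subset n) {i j} → i Fin.< j → members p i Fin.< members p j
members-strictMono (inside ∷ p) {zero} {suc j} _ = s≤s z≤n
members-strictMono (inside ∷ p) {suc i} {suc j} (s≤s i<j) = s≤s (members-strictMono p i<j)
members-strictMono (outside ∷ p) i<j = s≤s (members-strictMono p i<j)

-- A subset of Fin n is read as a set of naturals below n listed from the top: index zero
-- stands for n - 1. Then outside ∷ A is the same set in Fin (suc n), and zero ∈ B says that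
-- n - 1 is the largest element of B.
value : Fin n → ℕ
value {suc n} zero = n
value (suc i) = value i

value<n : ∀ (i : Fin n) → value i < n
value<n {suc n} zero = n<1+n n
value<n {suc n} (suc i) = m<n⇒m<1+n (value<n i)

<⇒value> : ∀ {i j : Fin n} → i Fin.< j → value j < value i
<⇒value> {i = zero} {suc j} _ = value<n j
<⇒value> {i = suc i} {suc j} (s≤s i<j) = <⇒value> i<j

_⊆ᵥ_ : ∀ {m} → Subset m → Subset n → Set
B ⊆ᵥ A = ∀ {b} → b ∈ B → ∃ λ a → a ∈ A × value a ≡ value b

⊆⇒⊆ᵥ : p ⊆ q → p ⊆ᵥ q
⊆⇒⊆ᵥ p⊆q b∈p = _ , p⊆q b∈p , refl

dropToTop : ∀ (A : Subset n) → Nonempty A →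
            Σ[ x ∈ ℕ ] Σ[ B ∈ Subset (suc x) ] zero ∈ B × ∣ B ∣ ≡ ∣ A ∣ × B ⊆ᵥ A
dropToTop {suc n} (inside ∷ A) _ = n , inside ∷ A , here , refl , ⊆⇒⊆ᵥ (λ b∈ → b∈)
dropToTop (outside ∷ A) (suc i , there i∈A) with dropToTop A (i , i∈A)
... | x , B , zero∈B , ∣B∣≡∣A∣ , B⊆ᵥA = x , B , zero∈B , ∣B∣≡∣A∣ , λ b∈B →
  let (a , a∈A , eq) = B⊆ᵥA b∈B in suc a , there a∈A , eq

-- Hall's marriage theorem

module _ {E : REL (Fin n) (Fin r) 0ℓ} (E? : B.Decidable E) where

  Neighbours : Subset n → Subset r
  Neighbours X = subsetOf (λ j → any? (λ i → (i ∈? X) ×-dec E? i j))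

  ∈-Neighbours⁻ : ∀ {X j} → j ∈ Neighbours X → ∃ λ i → i ∈ X × E i j
  ∈-Neighbours⁻ = ∈-subsetOf⁻ _

  ∈-Neighbours⁺ : ∀ {X i j} → i ∈ X → E i j → j ∈ Neighbours X
  ∈-Neighbours⁺ i∈X eij = ∈-subsetOf⁺ _ (_ , i∈X , eij)

  HallCondition : Subset n → Set
  HallCondition L = ∀ {X} → X ⊆ L → ∣ X ∣ ≤ ∣ Neighbours X ∣

record Matching (E : REL (Fin n) (Fin r) 0ℓ) (L : Subset n) : Set where
  field
    partner : Fin n → Fin r
    partner-edge : ∀ {i} → i ∈ L → E i (partner i)
    partner-injective : InjectiveOn partner L

open Matching

Avoiding : REL (Fin n) (Fin r) 0ℓ → Subset r → REL (Fin n) (Fin r) 0ℓ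
Avoiding E R i j = E i j × j ∉ R

avoiding? : ∀ {E : REL (Fin n) (Fin r) 0ℓ} → B.Decidable E → (R : Subset r) → B.Decidable (Avoiding E R)
avoiding? E? R i j = E? i j ×-dec ¬? (j ∈? R)

glue : ∀ {E : REL (Fin n) (Fin r) 0ℓ} {L : Subset n} (L₁ : Subset n) {R : Subset r} (M₁ : Matching E L₁) →
       (∀ {i} → i ∈ L₁ → partner M₁ i ∈ R) → Matching (Avoiding E R) (L ─ L₁) → Matching E L
glue {E = E} {L} L₁ M₁ M₁-into M₂ = record
  { partner = ψ ; partner-edge = ψ-edge ; partner-injective = ψ-injective }
  where
  ψ : Fin _ → Fin _
  ψ i with i ∈? L₁
  ... | yes _ = partner M₁ i
  ... | no _ = partner M₂ i

  ψ-edge : ∀ {i} → i ∈ L → E i (ψ i)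
  ψ-edge {i} i∈L with i ∈? L₁
  ... | yes i∈L₁ = partner-edge M₁ i∈L₁
  ... | no i∉L₁ = proj₁ (partner-edge M₂ (x∈p∧x∉q⇒x∈p─q i∈L i∉L₁))

  ψ-injective : InjectiveOn ψ L
  ψ-injective {i} {j} i∈L j∈L eq with i ∈? L₁ | j ∈? L₁
  ... | yes i∈L₁ | yes j∈L₁ = partner-injective M₁ i∈L₁ j∈L₁ eq
  ... | no i∉L₁ | no j∉L₁ =
    partner-injective M₂ (x∈p∧x∉q⇒x∈p─q i∈L i∉L₁) (x∈p∧x∉q⇒x∈p─q j∈L j∉L₁) eq
  ... | yes i∈L₁ | no j∉L₁ =
    ⊥-elim (proj₂ (partner-edge M₂ (x∈p∧x∉q⇒x∈p─q j∈L j∉L₁)) (subst (_∈ _) eq (M₁-into i∈L₁)))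
  ... | no i∉L₁ | yes j∈L₁ =
    ⊥-elim (proj₂ (partner-edge M₂ (x∈p∧x∉q⇒x∈p─q i∈L i∉L₁)) (subst (_∈ _) (sym eq) (M₁-into j∈L₁)))

module _ {E : REL (Fin n) (Fin r) 0ℓ} (E? : B.Decidable E) where

  HallCondition-avoidTight : ∀ {L X} → HallCondition E? L → X ⊆ L → ∣ Neighbours E? X ∣ ≤ ∣ X ∣ →
                             HallCondition (avoiding? E? (Neighbours E? X)) (L ─ X)
  HallCondition-avoidTight {L} {X} hallL X⊆L tight {Y} Y⊆L─X = +-cancelˡ-≤ ∣ X ∣ _ _ (begin
    ∣ X ∣ + ∣ Y ∣                       ≡⟨ Empty[p∩q]⇒∣p∪q∣≡∣p∣+∣q∣ X Y disjoint ⟨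
    ∣ X ∪ Y ∣                           ≤⟨ hallL X∪Y⊆L ⟩
    ∣ Neighbours E? (X ∪ Y) ∣           ≤⟨ p⊆q⇒∣p∣≤∣q∣ split ⟩
    ∣ Neighbours E? X ∪ Neighbours E′? Y ∣ ≤⟨ ∣p∪q∣≤∣p∣+∣q∣ (Neighbours E? X) (Neighbours E′? Y) ⟩
    ∣ Neighbours E? X ∣ + ∣ Neighbours E′? Y ∣ ≤⟨ +-monoˡ-≤ _ tight ⟩
    ∣ X ∣ + ∣ Neighbours E′? Y ∣        ∎)
    where
    open ≤-Reasoning
    E′? = avoiding? E? (Neighbours E? X)

    disjoint : Empty (X ∩ Y)
    disjoint (i , i∈X∩Y) = x∈p─q⇒x∉q L X (Y⊆L─X (proj₂ (x∈p∩q⁻ X Y i∈X∩Y))) (proj₁ (x∈p∩q⁻ X Y i∈X∩Y))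

    X∪Y⊆L : X ∪ Y ⊆ L
    X∪Y⊆L i∈X∪Y with x∈p∪q⁻ X Y i∈X∪Y
    ... | inj₁ i∈X = X⊆L i∈X
    ... | inj₂ i∈Y = p─q⊆p L X (Y⊆L─X i∈Y)

    split : Neighbours E? (X ∪ Y) ⊆ Neighbours E? X ∪ Neighbours E′? Y
    split {j} j∈N with j ∈? Neighbours E? X | ∈-Neighbours⁻ E? j∈N
    ... | yes j∈NX | _ = x∈p∪q⁺ (inj₁ j∈NX)
    ... | no j∉NX | i , i∈X∪Y , eij with x∈p∪q⁻ X Y i∈X∪Y
    ...   | inj₁ i∈X = ⊥-elim (j∉NX (∈-Neighbours⁺ E? i∈X eij))
    ...   | inj₂ i∈Y = x∈p∪q⁺ (inj₂ (∈-Neighbours⁺ E′? i∈Y (eij , j∉NX)))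

  HallCondition-avoidVertex : ∀ {L} r₀ → (∀ {Y} → Y ⊆ L → Nonempty Y → ∣ Y ∣ < ∣ Neighbours E? Y ∣) →
                              HallCondition (avoiding? E? ⁅ r₀ ⁆) L
  HallCondition-avoidVertex {L} r₀ surplus {Y} Y⊆L with nonempty? Y
  ... | no emptyY = ≤-trans (≤-reflexive (Empty⇒∣p∣≡0 emptyY)) z≤n
  ... | yes nonemptyY = ≤-pred (begin-strict
    ∣ Y ∣                                   <⟨ surplus Y⊆L nonemptyY ⟩
    ∣ Neighbours E? Y ∣                     ≤⟨ p⊆q⇒∣p∣≤∣q∣ split ⟩
    ∣ ⁅ r₀ ⁆ ∪ Neighbours E′? Y ∣           ≤⟨ ∣p∪q∣≤∣p∣+∣q∣ ⁅ r₀ ⁆ (Neighbours E′? Y) ⟩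
    ∣ ⁅ r₀ ⁆ ∣ + ∣ Neighbours E′? Y ∣       ≡⟨ cong (_+ ∣ Neighbours E′? Y ∣) (∣⁅x⁆∣≡1 r₀) ⟩
    suc ∣ Neighbours E′? Y ∣                ∎)
    where
    open ≤-Reasoning
    E′? = avoiding? E? ⁅ r₀ ⁆

    split : Neighbours E? Y ⊆ ⁅ r₀ ⁆ ∪ Neighbours E′? Y
    split {j} j∈N with j ∈? ⁅ r₀ ⁆ | ∈-Neighbours⁻ E? j∈N
    ... | yes j∈r₀ | _ = x∈p∪q⁺ (inj₁ j∈r₀)
    ... | no j∉r₀ | i , i∈Y , eij = x∈p∪q⁺ (inj₂ (∈-Neighbours⁺ E′? i∈Y (eij , j∉r₀)))

Tight : ∀ {E : REL (Fin n) (Fin r) 0ℓ} → B.Decidable E → Subset n → Subset n → Set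
Tight E? L X = X ⊂ L × Nonempty X × ∣ Neighbours E? X ∣ ≤ ∣ X ∣

tight? : ∀ {E : REL (Fin n) (Fin r) 0ℓ} (E? : B.Decidable E) L → U.Decidable (Tight E? L)
tight? E? L X = (X ⊂? L) ×-dec nonempty? X ×-dec (∣ Neighbours E? X ∣ ≤? ∣ X ∣)

singletonMatching : ∀ {E : REL (Fin n) (Fin r) 0ℓ} {l r₀} → E l r₀ → Matching E ⁅ l ⁆
singletonMatching {E = E} {l} {r₀} elr₀ = record
  { partner = λ _ → r₀
  ; partner-edge = λ i∈l → subst (λ i → E i r₀) (sym (x∈⁅y⁆⇒x≡y l i∈l)) elr₀
  ; partner-injective = λ i∈l j∈l _ → trans (x∈⁅y⁆⇒x≡y l i∈l) (sym (x∈⁅y⁆⇒x≡y l j∈l))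
  }

-- Halmos–Vaughan: if a nonempty X ⊂ L has no surplus, match X into N(X) and L ─ X avoiding
-- N(X); otherwise any single edge can be fixed. The first argument is the (irrelevant) partner
-- of vertices outside L.
hall : Fin r → ∀ {E : REL (Fin n) (Fin r) 0ℓ} (E? : B.Decidable E) L → HallCondition E? L → Matching E L
hall default E? L = go (⊂-wellFounded L) E?
  where
  go : ∀ {L} → Acc _⊂_ L → ∀ {E} (E? : B.Decidable E) → HallCondition E? L → Matching E L
  go {L} (acc smaller) {E} E? hallL with anySubset? (tight? E? L)
  ... | yes (X , X⊂L@(X⊆L , _) , (x , x∈X) , tight) =
    glue X M₁ (λ i∈X → ∈-Neighbours⁺ E? i∈X (partner-edge M₁ i∈X))
      (go (smaller (p∩q≢∅⇒p─q⊂p L X (x , x∈p∩q⁺ (X⊆L x∈X , x∈X))))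
          (avoiding? E? (Neighbours E? X)) (HallCondition-avoidTight E? hallL X⊆L tight))
    where
    M₁ = go (smaller X⊂L) E? (λ Y⊆X → hallL (⊆-trans Y⊆X X⊆L))
  ... | no noTight with nonempty? L
  ...   | no emptyL = record
    { partner = λ _ → default
    ; partner-edge = λ i∈L → ⊥-elim (emptyL (_ , i∈L))
    ; partner-injective = λ i∈L _ _ → ⊥-elim (emptyL (_ , i∈L))
    }
  ...   | yes (l , l∈L) =
    glue ⁅ l ⁆ (singletonMatching elr₀) (λ _ → x∈⁅x⁆ r₀)
      (go (smaller (x∈p⇒p-x⊂p l∈L)) (avoiding? E? ⁅ r₀ ⁆) (HallCondition-avoidVertex E? r₀ surplus))
    where
    r₀∈N : Nonempty (Neighbours E? ⁅ l ⁆)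
    r₀∈N = 0<∣p∣⇒Nonempty _ (subst (_≤ ∣ Neighbours E? ⁅ l ⁆ ∣) (∣⁅x⁆∣≡1 l) (hallL ⁅l⁆⊆L))
      where
      ⁅l⁆⊆L : ⁅ l ⁆ ⊆ L
      ⁅l⁆⊆L i∈l = subst (_∈ L) (sym (x∈⁅y⁆⇒x≡y l i∈l)) l∈L
    r₀ = proj₁ r₀∈N
    elr₀ : E l r₀
    elr₀ with ∈-Neighbours⁻ E? (proj₂ r₀∈N)
    ... | i , i∈l , eir₀ = subst (λ i → E i r₀) (x∈⁅y⁆⇒x≡y l i∈l) eir₀
    surplus : ∀ {Y} → Y ⊆ L - l → Nonempty Y → ∣ Y ∣ < ∣ Neighbours E? Y ∣
    surplus {Y} Y⊆L-l nonemptyY = ≰⇒> λ tightY → noTight (Y , Y⊂L , nonemptyY , tightY)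
      where
      Y⊂L : Y ⊂ L
      Y⊂L = (p─q⊆p L ⁅ l ⁆ ∘ Y⊆L-l) , l , l∈L , λ l∈Y → x∈p─q⇒x∉q L ⁅ l ⁆ (Y⊆L-l l∈Y) (x∈⁅x⁆ l)

-- Maximal and minimal elements

IsAntichain : B.Rel (Fin n) 0ℓ → Subset n → Set
IsAntichain _⊏_ A = ∀ {a} → a ∈ A → ∀ {b} → b ∈ A → ¬ a ⊏ b

module Maximal {_⊏_ : B.Rel (Fin n) 0ℓ} (_⊏?_ : B.Decidable _⊏_) where

  maximal : Subset n → Subset n
  maximal C = subsetOf λ c → (c ∈? C) ×-dec ¬? (any? λ b → (b ∈? C) ×-dec (c ⊏? b))

  maximal⊆ : ∀ {C} → maximal C ⊆ C
  maximal⊆ c∈max = proj₁ (∈-subsetOf⁻ _ c∈max)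

  maximal-isMaximal : ∀ {C c b} → c ∈ maximal C → b ∈ C → ¬ c ⊏ b
  maximal-isMaximal c∈max b∈C c⊏b = proj₂ (∈-subsetOf⁻ _ c∈max) (_ , b∈C , c⊏b)

  ∈-maximal : ∀ {C c} → c ∈ C → (∀ {b} → b ∈ C → ¬ c ⊏ b) → c ∈ maximal C
  ∈-maximal c∈C isMaximal = ∈-subsetOf⁺ _ (c∈C , λ (_ , b∈C , c⊏b) → isMaximal b∈C c⊏b)

  maximal-isAntichain : ∀ {C} → IsAntichain _⊏_ (maximal C)
  maximal-isAntichain a∈max b∈max = maximal-isMaximal a∈max (maximal⊆ b∈max)

open Maximal

minimal : ∀ {_⊏_ : B.Rel (Fin n) 0ℓ} → B.Decidable _⊏_ → Subset n → Subset n
minimal _⊏?_ = maximal (flip _⊏?_)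

minimal-isAntichain : ∀ {_⊏_ : B.Rel (Fin n) 0ℓ} (_⊏?_ : B.Decidable _⊏_) {C} →
                      IsAntichain _⊏_ (minimal _⊏?_ C)
minimal-isAntichain _⊏?_ a∈min b∈min = maximal-isAntichain (flip _⊏?_) b∈min a∈min

∣A∣+∣B∣≤∣maximal∣+∣minimal∣ : ∀ {_⊏_ : B.Rel (Fin n) 0ℓ} (_⊏?_ : B.Decidable _⊏_) → B.Transitive _⊏_ →
  ∀ {A B} → IsAntichain _⊏_ A → IsAntichain _⊏_ B →
  ∣ A ∣ + ∣ B ∣ ≤ ∣ maximal _⊏?_ (A ∪ B) ∣ + ∣ minimal _⊏?_ (A ∪ B) ∣
∣A∣+∣B∣≤∣maximal∣+∣minimal∣ {_⊏_ = _⊏_} _⊏?_ ⊏-trans {A} {B} antiA antiB = begin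
  ∣ A ∣ + ∣ B ∣                    ≡⟨ ∣p∪q∣+∣p∩q∣≡∣p∣+∣q∣ A B ⟨
  ∣ A ∪ B ∣ + ∣ A ∩ B ∣            ≤⟨ +-mono-≤ (p⊆q⇒∣p∣≤∣q∣ covered) (p⊆q⇒∣p∣≤∣q∣ isolated) ⟩
  ∣ Max ∪ Min ∣ + ∣ Max ∩ Min ∣    ≡⟨ ∣p∪q∣+∣p∩q∣≡∣p∣+∣q∣ Max Min ⟩
  ∣ Max ∣ + ∣ Min ∣                ∎
  where
  open ≤-Reasoning
  C = A ∪ B
  Max = maximal _⊏?_ C
  Min = minimal _⊏?_ C

  no-3-chain : ∀ {a b c} → a ∈ C → b ∈ C → c ∈ C → a ⊏ b → b ⊏ c → Data.Empty.⊥
  no-3-chain a∈C b∈C c∈C a⊏b b⊏c with x∈p∪q⁻ A B a∈C | x∈p∪q⁻ A B b∈C | x∈p∪q⁻ A B c∈C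
  ... | inj₁ a∈A | inj₁ b∈A | _        = antiA a∈A b∈A a⊏b
  ... | _        | inj₁ b∈A | inj₁ c∈A = antiA b∈A c∈A b⊏c
  ... | inj₂ a∈B | inj₁ _   | inj₂ c∈B = antiB a∈B c∈B (⊏-trans a⊏b b⊏c)
  ... | inj₂ a∈B | inj₂ b∈B | _        = antiB a∈B b∈B a⊏b
  ... | _        | inj₂ b∈B | inj₂ c∈B = antiB b∈B c∈B b⊏c
  ... | inj₁ a∈A | inj₂ _   | inj₁ c∈A = antiA a∈A c∈A (⊏-trans a⊏b b⊏c)

  covered : C ⊆ Max ∪ Min
  covered {c} c∈C with any? (λ b → (b ∈? C) ×-dec (c ⊏? b))
  ... | yes (b , b∈C , c⊏b) =
    x∈p∪q⁺ (inj₂ (∈-maximal (flip _⊏?_) c∈C λ a∈C a⊏c → no-3-chain a∈C c∈C b∈C a⊏c c⊏b))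
  ... | no nothingAbove = x∈p∪q⁺ (inj₁ (∈-maximal _⊏?_ c∈C λ b∈C c⊏b → nothingAbove (_ , b∈C , c⊏b)))

  incomparable : ∀ {c b} → c ∈ A ∩ B → b ∈ C → ¬ c ⊏ b × ¬ b ⊏ c
  incomparable c∈A∩B b∈C with x∈p∩q⁻ A B c∈A∩B | x∈p∪q⁻ A B b∈C
  ... | c∈A , _ | inj₁ b∈A = antiA c∈A b∈A , antiA b∈A c∈A
  ... | _ , c∈B | inj₂ b∈B = antiB c∈B b∈B , antiB b∈B c∈B

  isolated : A ∩ B ⊆ Max ∩ Min
  isolated c∈A∩B = x∈p∩q⁺
    ( ∈-maximal _⊏?_ c∈C (proj₁ ∘ incomparable c∈A∩B)
    , ∈-maximal (flip _⊏?_) c∈C (proj₂ ∘ incomparable c∈A∩B))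
    where c∈C = x∈p∪q⁺ (inj₁ (proj₁ (x∈p∩q⁻ A B c∈A∩B)))

suc+[2+n]C2≤[3+n]C2 : ∀ n → suc n + suc (suc n) C 2 ≤ suc (suc (suc n)) C 2
suc+[2+n]C2≤[3+n]C2 n = begin
  suc n + suc (suc n) C 2         ≤⟨ +-monoˡ-≤ _ (n≤1+n (suc n)) ⟩
  suc (suc n) + suc (suc n) C 2   ≡⟨ cong (_+ suc (suc n) C 2) (nC1≡n (suc (suc n))) ⟨
  suc (suc n) C 1 + suc (suc n) C 2 ≡⟨ nCk+nC[k+1]≡[n+1]C[k+1] (suc (suc n)) 1 ⟩
  suc (suc (suc n)) C 2           ∎
  where open ≤-Reasoning

-- The order of a colouring that is transitive for colour 0

module _ (f : Coloring2) (f-transitive : TransitiveFor f zero) where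

  _≺_ : ℕ → ℕ → Set
  x ≺ y = x < y × f x y ≡ zero

  _≺?_ : B.Decidable _≺_
  x ≺? y = (x <? y) ×-dec (f x y ≟ zero)

  ≺-trans : B.Transitive _≺_
  ≺-trans {x} {y} {z} (x<y , fxy≡0) (y<z , fyz≡0) = <-trans x<y y<z , f-transitive x y z x<y y<z fxy≡0 fyz≡0

  _≼_ : ℕ → ℕ → Set
  x ≼ y = x ≡ y ⊎ x ≺ y

  _≼?_ : B.Decidable _≼_
  x ≼? y = (x ≟ℕ y) ⊎-dec (x ≺? y)

  ≼-≺-trans : ∀ {x y z} → x ≼ y → y ≺ z → x ≺ z
  ≼-≺-trans (inj₁ refl) y≺z = y≺z
  ≼-≺-trans (inj₂ x≺y) y≺z = ≺-trans x≺y y≺z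

  ≼-trans : ∀ {x y z} → x ≼ y → y ≼ z → x ≼ z
  ≼-trans x≼y (inj₁ refl) = x≼y
  ≼-trans x≼y (inj₂ y≺z) = inj₂ (≼-≺-trans x≼y y≺z)

  _⊏_ : ∀ {u} → B.Rel (Fin u) 0ℓ
  a ⊏ b = value a ≺ value b

  _⊏?_ : ∀ {u} → B.Decidable (_⊏_ {u})
  a ⊏? b = value a ≺? value b

  record AntichainIn (S : ℕ → Set) (A : Subset n) : Set where
    constructor antichainIn
    field
      inS : ∀ {a} → a ∈ A → S (value a)
      incomparable : IsAntichain _⊏_ A

  open AntichainIn

  antichainIn? : ∀ {S} → U.Decidable S → (A : Subset n) → Dec (AntichainIn S A)
  antichainIn? S? A with decFinSubset (_∈? A) (λ {a} _ → S? (value a))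
                     | decFinSubset (_∈? A) (λ {a} _ → decFinSubset (_∈? A) (λ {b} _ → ¬? (a ⊏? b)))
  ... | yes A-inS | yes A-incomparable = yes (antichainIn A-inS A-incomparable)
  ... | no ¬inS | _ = no (¬inS ∘ inS)
  ... | _ | no ¬incomparable = no (¬incomparable ∘ incomparable)

  AntichainIn-⊆ᵥ : ∀ {m S} {A : Subset n} {B : Subset m} → B ⊆ᵥ A → AntichainIn S A → AntichainIn S B
  AntichainIn-⊆ᵥ {S = S} B⊆ᵥA (antichainIn A-inS A-antichain) = antichainIn B-inS B-antichain
    where
    B-inS : ∀ {b} → b ∈ _ → S (value b)
    B-inS b∈B with B⊆ᵥA b∈B
    ... | _ , a∈A , eq = subst S eq (A-inS a∈A)
    B-antichain : IsAntichain _⊏_ _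
    B-antichain b∈B b′∈B with B⊆ᵥA b∈B | B⊆ᵥA b′∈B
    ... | _ , a∈A , eq | _ , a′∈A , eq′ = A-antichain a∈A a′∈A ∘ subst₂ _≺_ (sym eq) (sym eq′)

  WidthAtMost : (ℕ → Set) → ℕ → Set
  WidthAtMost S w = ∀ {u} (A : Subset u) → AntichainIn S A → ∣ A ∣ ≤ w

  ChainCover : (ℕ → Set) → ℕ → Set
  ChainCover S c = Σ[ g ∈ (ℕ → Fin c) ] ∀ {x y} → S x → S y → x < y → g x ≡ g y → f x y ≡ zero

  antichain⇒homogeneous : ∀ {n} {A : Subset n} {k} → IsAntichain _⊏_ A → k ≤ ∣ A ∣ →
                          HasHomogeneousOfSize f (suc zero) k
  antichain⇒homogeneous {n} {A} {k} antichain k≤∣A∣ = h , h-increasing , h-homogeneous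
    where
    pick : Fin k → Fin n
    pick a = members A (inject≤ (opposite a) k≤∣A∣)

    h : Fin k → ℕ
    h = value ∘ pick

    h-increasing : StrictlyIncreasing h
    h-increasing a b a<b = <⇒value> (members-strictMono A (begin-strict
      toℕ (inject≤ (opposite b) k≤∣A∣) ≡⟨ toℕ-inject≤ (opposite b) k≤∣A∣ ⟩
      toℕ (opposite b)                 <⟨ <⇒opposite> a<b ⟩
      toℕ (opposite a)                 ≡⟨ toℕ-inject≤ (opposite a) k≤∣A∣ ⟨
      toℕ (inject≤ (opposite a) k≤∣A∣) ∎))
      where open ≤-Reasoning

    h-homogeneous : HomogeneousFor f (suc zero) (Range h)
    h-homogeneous _ _ (a , refl) (b , refl) ha<hb =
      ≢0⇒≡1 _ (λ fab≡0 → antichain (members-∈ A _) (members-∈ A _) (ha<hb , fab≡0))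

  ¬homogeneous⇒WidthAtMost : ∀ {S w} → ¬ HasHomogeneousOfSize f (suc zero) (suc w) → WidthAtMost S w
  ¬homogeneous⇒WidthAtMost {w = w} noHomogeneous A antichain with ∣ A ∣ ≤? w
  ... | yes ∣A∣≤w = ∣A∣≤w
  ... | no ∣A∣≰w = ⊥-elim (noHomogeneous (antichain⇒homogeneous (incomparable antichain) (≰⇒> ∣A∣≰w)))

  WidthAtMost0⇒∉ : ∀ {S x} → WidthAtMost S 0 → ¬ S x
  WidthAtMost0⇒∉ {S} {x} width≤ Sx = n≮0 (width≤ ⁅ zero {x} ⁆ (antichainIn singleton-S singleton-antichain))
    where
    singleton-S : ∀ {a} → a ∈ ⁅ zero ⁆ → S (value a)
    singleton-S a∈ = subst (S ∘ value) (sym (x∈⁅y⁆⇒x≡y zero a∈)) Sx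
    singleton-antichain : IsAntichain _⊏_ ⁅ zero ⁆
    singleton-antichain a∈ b∈ (a<b , _) =
      <-irrefl (cong value (trans (x∈⁅y⁆⇒x≡y zero a∈) (sym (x∈⁅y⁆⇒x≡y zero b∈)))) a<b

  ChainCover-inject≤ : ∀ {S a b} → a ≤ b → ChainCover S a → ChainCover S b
  ChainCover-inject≤ a≤b (g , chains) =
    (λ x → inject≤ (g x) a≤b) , λ Sx Sy x<y eq → chains Sx Sy x<y (inject≤-injective a≤b a≤b _ _ eq)

  ChainCover-split : ∀ {S T a b} → U.Decidable T →
                     ChainCover T a → ChainCover (λ x → S x × ¬ T x) b → ChainCover S (a + b)
  ChainCover-split {S} {T} {a} {b} T? (g , g-chains) (h , h-chains) =
    colour , λ {x y} → chains (T? x) (T? y)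
    where
    colourBy : ∀ x → Dec (T x) → Fin (a + b)
    colourBy x (yes _) = g x ↑ˡ b
    colourBy x (no _) = a ↑ʳ h x

    colour : ℕ → Fin (a + b)
    colour x = colourBy x (T? x)

    chains : ∀ {x y} (Tx? : Dec (T x)) (Ty? : Dec (T y)) → S x → S y → x < y →
             colourBy x Tx? ≡ colourBy y Ty? → f x y ≡ zero
    chains (yes Tx) (yes Ty) _ _ x<y eq = g-chains Tx Ty x<y (↑ˡ-injective b _ _ eq)
    chains (no ¬Tx) (no ¬Ty) Sx Sy x<y eq = h-chains (Sx , ¬Tx) (Sy , ¬Ty) x<y (↑ʳ-injective a _ _ eq)
    chains (yes _) (no _) _ _ _ eq = ⊥-elim (↑ˡ≢↑ʳ eq)
    chains (no _) (yes _) _ _ _ eq = ⊥-elim (↑ˡ≢↑ʳ (sym eq))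

  Below : Maybe ℕ → ℕ → Set
  Below nothing _ = ⊤
  Below (just τ) x = τ ≼ x

  below? : ∀ o x → Dec (Below o x)
  below? nothing _ = yes tt
  below? (just τ) x = τ ≼? x

  Below-≼ : ∀ {o x y} → Below o x → x ≼ y → Below o y
  Below-≼ {nothing} _ _ = tt
  Below-≼ {just τ} τ≼x x≼y = ≼-trans τ≼x x≼y

  module TopLayer {S : ℕ → Set} (S? : U.Decidable S) (w : ℕ) (width≤ : WidthAtMost S (suc w)) where

    TopOfWideAntichain : ℕ → Set
    TopOfWideAntichain x = Σ[ B ∈ Subset (suc x) ] zero ∈ B × AntichainIn S B × suc w ≤ ∣ B ∣

    topOfWideAntichain? : U.Decidable TopOfWideAntichain
    topOfWideAntichain? x = anySubset? λ B → (zero ∈? B) ×-dec antichainIn? S? B ×-dec (suc w ≤? ∣ B ∣)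

    Residual : ℕ → Set
    Residual x = S x × ¬ TopOfWideAntichain x

    residual? : U.Decidable Residual
    residual? x = S? x ×-dec ¬? (topOfWideAntichain? x)

    WidthAtMost-Residual : WidthAtMost Residual w
    WidthAtMost-Residual A A-antichain with ∣ A ∣ ≤? w
    ... | yes ∣A∣≤w = ∣A∣≤w
    ... | no ∣A∣≰w with dropToTop A (0<∣p∣⇒Nonempty A (≤-trans (s≤s z≤n) (≰⇒> ∣A∣≰w)))
    ...   | x , B , zero∈B , ∣B∣≡∣A∣ , B⊆ᵥA with B⊆ᵥA zero∈B
    ...     | a , a∈A , value-a≡x =
      ⊥-elim (proj₂ (inS A-antichain a∈A) (subst TopOfWideAntichain (sym value-a≡x) x-top))
      where
      B-antichain : AntichainIn S B
      B-antichain = AntichainIn-⊆ᵥ B⊆ᵥA (antichainIn (proj₁ ∘ inS A-antichain) (incomparable A-antichain))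
      x-top : TopOfWideAntichain x
      x-top = B , zero∈B , B-antichain , subst (suc w ≤_) (sym ∣B∣≡∣A∣) (≰⇒> ∣A∣≰w)

    -- tops c is the last element put on chain c, nothing while c is empty.
    Tops : Set
    Tops = Vector (Maybe ℕ) (suc w)

    setTop : Tops → Fin (suc w) → ℕ → Tops
    setTop tops c t = updateAt tops c (const (just t))

    AboveTop : ∀ {u} → Tops → REL (Fin u) (Fin (suc w)) 0ℓ
    AboveTop tops a c = Below (tops c) (value a)

    aboveTop? : ∀ {u} (tops : Tops) → B.Decidable (AboveTop {u} tops)
    aboveTop? tops a c = below? (tops c) (value a)

    AllEmpty : Tops → Set
    AllEmpty tops = ∀ c → tops c ≡ nothing

    record DominatingAntichain (u : ℕ) (tops : Tops) : Set where
      field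
        antichain : Subset u
        isAntichain : AntichainIn S antichain
        wide : suc w ≤ ∣ antichain ∣
        matching : Matching (AboveTop tops) antichain

    Invariant : ℕ → Tops → Set
    Invariant t tops = AllEmpty tops ⊎ DominatingAntichain t tops

    widen : ∀ {t tops} → Invariant t tops → Invariant (suc t) tops
    widen (inj₁ empty) = inj₁ empty
    widen (inj₂ D) = inj₂ record
      { antichain = outside ∷ antichain
      ; isAntichain = antichainIn (λ { (there a∈A) → inS isAntichain a∈A })
                                  (λ { (there a∈A) (there b∈A) → incomparable isAntichain a∈A b∈A })
      ; wide = wide
      ; matching = record
        { partner = λ { zero → zero ; (suc a) → partner matching a }
        ; partner-edge = λ { (there a∈A) → partner-edge matching a∈A }
        ; partner-injective = λ { (there a∈A) (there b∈A) eq →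
                                    cong suc (partner-injective matching a∈A b∈A eq) }
        }
      }
      where open DominatingAntichain D

    HallCondition-allEmpty : ∀ {u tops} {M : Subset u} → AllEmpty tops → AntichainIn S M →
                             HallCondition (aboveTop? tops) M
    HallCondition-allEmpty {tops = tops} {M} empty M-antichain {X} X⊆M with nonempty? X
    ... | no emptyX = subst (_≤ ∣ Neighbours (aboveTop? tops) X ∣) (sym (Empty⇒∣p∣≡0 emptyX)) z≤n
    ... | yes (x , x∈X) = begin
      ∣ X ∣                            ≤⟨ width≤ X (AntichainIn-⊆ᵥ (⊆⇒⊆ᵥ X⊆M) M-antichain) ⟩
      suc w                            ≡⟨ ∣⊤∣≡n (suc w) ⟨
      ∣ Subset.⊤ {suc w} ∣             ≤⟨ p⊆q⇒∣p∣≤∣q∣ everyChain ⟩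
      ∣ Neighbours (aboveTop? tops) X ∣ ∎
      where
      open ≤-Reasoning
      everyChain : Subset.⊤ ⊆ Neighbours (aboveTop? tops) X
      everyChain {c} _ =
        ∈-Neighbours⁺ (aboveTop? tops) x∈X (subst (λ o → Below o (value x)) (sym (empty c)) tt)

    below : ∀ {u} → Subset u → Subset u → Subset u
    below A X = subsetOf λ a → (a ∈? A) ×-dec any? (λ x → (x ∈? X) ×-dec (value a ≼? value x))

    AntichainIn-─below-∪ : ∀ {u} {A X : Subset u} → AntichainIn S A → AntichainIn S X →
                           (∀ {x a} → x ∈ X → a ∈ A → ¬ x ⊏ a) → AntichainIn S ((A ─ below A X) ∪ X)
    AntichainIn-─below-∪ {A = A} {X} (antichainIn A-inS A-antichain) (antichainIn X-inS X-antichain) X-notBelowA =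
      antichainIn inS′ antichain
      where
      inS′ : ∀ {a} → a ∈ (A ─ below A X) ∪ X → S (value a)
      inS′ a∈ with x∈p∪q⁻ (A ─ below A X) X a∈
      ... | inj₁ a∈A─ = A-inS (p─q⊆p A _ a∈A─)
      ... | inj₂ a∈X = X-inS a∈X

      antichain : IsAntichain _⊏_ ((A ─ below A X) ∪ X)
      antichain a∈ b∈ with x∈p∪q⁻ (A ─ below A X) X a∈ | x∈p∪q⁻ (A ─ below A X) X b∈
      ... | inj₁ a∈A─ | inj₁ b∈A─ = A-antichain (p─q⊆p A _ a∈A─) (p─q⊆p A _ b∈A─)
      ... | inj₂ a∈X | inj₂ b∈X = X-antichain a∈X b∈X
      ... | inj₂ a∈X | inj₁ b∈A─ = X-notBelowA a∈X (p─q⊆p A _ b∈A─)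
      ... | inj₁ a∈A─ | inj₂ b∈X = λ a⊏b →
        x∈p─q⇒x∉q A _ a∈A─ (∈-subsetOf⁺ _ (p─q⊆p A _ a∈A─ , _ , b∈X , inj₂ a⊏b))

    HallCondition-dominated : ∀ {u tops} (D : DominatingAntichain u tops) {M : Subset u} → AntichainIn S M →
      (∀ {x a} → x ∈ M → a ∈ DominatingAntichain.antichain D → ¬ x ⊏ a) → HallCondition (aboveTop? tops) M
    HallCondition-dominated {tops = tops} D {M} M-antichain M-notBelowA {X} X⊆M =
      ≤-trans ∣X∣≤∣A↓X∣ ∣A↓X∣≤∣N[X]∣
      where
      open DominatingAntichain D renaming (antichain to A)
      A↓X = below A X
      A─A↓X = A ─ A↓X

      A↓X⊆A : A↓X ⊆ A
      A↓X⊆A a∈A↓X = proj₁ (∈-subsetOf⁻ _ a∈A↓X)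

      ∣A↓X∣≤∣N[X]∣ : ∣ A↓X ∣ ≤ ∣ Neighbours (aboveTop? tops) X ∣
      ∣A↓X∣≤∣N[X]∣ = InjectiveOn⇒∣p∣≤∣q∣ (partner matching)
        (λ a∈ b∈ → partner-injective matching (A↓X⊆A a∈) (A↓X⊆A b∈))
        (λ a∈A↓X → let (a∈A , x , x∈X , a≼x) = ∈-subsetOf⁻ _ a∈A↓X in
          ∈-Neighbours⁺ (aboveTop? tops) x∈X (Below-≼ (partner-edge matching a∈A) a≼x))

      disjoint : Empty (A─A↓X ∩ X)
      disjoint (x , x∈) with x∈p∩q⁻ A─A↓X X x∈
      ... | x∈A─A↓X , x∈X =
        x∈p─q⇒x∉q A A↓X x∈A─A↓X (∈-subsetOf⁺ _ (p─q⊆p A A↓X x∈A─A↓X , x , x∈X , inj₁ refl))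

      ∣X∣≤∣A↓X∣ : ∣ X ∣ ≤ ∣ A↓X ∣
      ∣X∣≤∣A↓X∣ = +-cancelˡ-≤ ∣ A─A↓X ∣ _ _ (begin
        ∣ A─A↓X ∣ + ∣ X ∣      ≡⟨ Empty[p∩q]⇒∣p∪q∣≡∣p∣+∣q∣ A─A↓X X disjoint ⟨
        ∣ A─A↓X ∪ X ∣          ≤⟨ width≤ _ rest∪X-antichain ⟩
        suc w                  ≤⟨ wide ⟩
        ∣ A ∣                  ≤⟨ ∣p∣≤∣p─q∣+∣q∣ A A↓X ⟩
        ∣ A─A↓X ∣ + ∣ A↓X ∣    ∎)
        where
        open ≤-Reasoning
        rest∪X-antichain : AntichainIn S (A─A↓X ∪ X)
        rest∪X-antichain = AntichainIn-─below-∪ isAntichain (AntichainIn-⊆ᵥ (⊆⇒⊆ᵥ X⊆M) M-antichain)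
                                                (λ x∈X → M-notBelowA (X⊆M x∈X))

    rematch : ∀ {t tops} {M : Subset (suc t)} → AntichainIn S M → suc w ≤ ∣ M ∣ → zero ∈ M →
             HallCondition (aboveTop? tops) M →
             Σ[ c ∈ Fin (suc w) ] Below (tops c) t × DominatingAntichain (suc t) (setTop tops c t)
    rematch {t} {tops} {M} M-antichain M-wide zero∈M hallM =
      c , partner-edge ψ zero∈M , record
        { antichain = M ; isAntichain = M-antichain ; wide = M-wide
        ; matching = record
          { partner = partner ψ ; partner-edge = edge ; partner-injective = partner-injective ψ } }
      where
      ψ = hall zero (aboveTop? tops) M hallM
      c = partner ψ zero

      edge : ∀ {a} → a ∈ M → AboveTop (setTop tops c t) a (partner ψ a)
      edge {a} a∈M with partner ψ a ≟ c
      ... | no ψa≢c =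
        subst (λ o → Below o (value a)) (sym (updateAt-minimal _ _ tops ψa≢c)) (partner-edge ψ a∈M)
      ... | yes ψa≡c with partner-injective ψ a∈M zero∈M ψa≡c
      ...   | refl = subst (λ o → Below o t) (sym (updateAt-updates c tops)) (inj₁ refl)

    placement : ∀ {t tops} → Invariant (suc t) tops → TopOfWideAntichain t →
             Σ[ c ∈ Fin (suc w) ] Below (tops c) t × DominatingAntichain (suc t) (setTop tops c t)
    placement (inj₁ empty) (B , zero∈B , B-antichain , B-wide) =
      rematch B-antichain B-wide zero∈B (HallCondition-allEmpty empty B-antichain)
    placement {t} (inj₂ D) (B , zero∈B , B-antichain , B-wide) =
      rematch M-antichain M-wide zero∈M (HallCondition-dominated D M-antichain M-notBelowA)
      where
      open DominatingAntichain D renaming (antichain to A)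
      C = A ∪ B
      M = maximal _⊏?_ C
      M′ = minimal _⊏?_ C

      C-inS : ∀ {c} → c ∈ C → S (value c)
      C-inS c∈C with x∈p∪q⁻ A B c∈C
      ... | inj₁ c∈A = inS isAntichain c∈A
      ... | inj₂ c∈B = inS B-antichain c∈B

      M-antichain : AntichainIn S M
      M-antichain = antichainIn (C-inS ∘ maximal⊆ _⊏?_) (maximal-isAntichain _⊏?_)

      M′-antichain : AntichainIn S M′
      M′-antichain = antichainIn (C-inS ∘ maximal⊆ (flip _⊏?_)) (minimal-isAntichain _⊏?_)

      M-notBelowA : ∀ {x a} → x ∈ M → a ∈ A → ¬ x ⊏ a
      M-notBelowA x∈M a∈A = maximal-isMaximal _⊏?_ x∈M (x∈p∪q⁺ (inj₁ a∈A))

      zero∈M : zero ∈ M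
      zero∈M = ∈-maximal _⊏?_ (x∈p∪q⁺ (inj₂ zero∈B)) λ {b} _ (t<b , _) → <⇒≱ t<b (≤-pred (value<n b))

      M-wide : suc w ≤ ∣ M ∣
      M-wide = ≤-trans wide (+-cancelʳ-≤ (∣ B ∣) (∣ A ∣) (∣ M ∣) (begin
        ∣ A ∣ + ∣ B ∣   ≤⟨ ∣A∣+∣B∣≤∣maximal∣+∣minimal∣ _⊏?_ ≺-trans
                             (incomparable isAntichain) (incomparable B-antichain) ⟩
        ∣ M ∣ + ∣ M′ ∣  ≤⟨ +-monoʳ-≤ ∣ M ∣ (≤-trans (width≤ M′ M′-antichain) B-wide) ⟩
        ∣ M ∣ + ∣ B ∣   ∎))
        where open ≤-Reasoning

    State : ℕ → Set
    State t = Σ Tops (Invariant t)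

    next : ∀ t → State t → Dec (TopOfWideAntichain t) → State (suc t)
    next t (tops , inv) (yes top) = setTop tops (proj₁ e) t , inj₂ (proj₂ (proj₂ e))
      where e = placement (widen inv) top
    next t (tops , inv) (no _) = tops , widen inv

    chosen : ∀ t → State t → Dec (TopOfWideAntichain t) → Fin (suc w)
    chosen t (tops , inv) (yes top) = proj₁ (placement (widen inv) top)
    chosen t _ (no _) = zero

    state : ∀ t → State t
    state zero = (λ _ → nothing) , inj₁ (λ _ → refl)
    state (suc t) = next t (state t) (topOfWideAntichain? t)

    topsAt : ℕ → Tops
    topsAt t = proj₁ (state t)

    colour : ℕ → Fin (suc w)
    colour t = chosen t (state t) (topOfWideAntichain? t)

    setTop-lookup : ∀ tops c′ t c → (c ≡ c′ × setTop tops c′ t c ≡ just t) ⊎ setTop tops c′ t c ≡ tops c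
    setTop-lookup tops c′ t c with c ≟ c′
    ... | yes refl = inj₁ (refl , updateAt-updates c tops)
    ... | no c≢c′ = inj₂ (updateAt-minimal c c′ tops c≢c′)

    next-topsBelow : ∀ {t} (s : State t) d → (∀ c {τ} → proj₁ s c ≡ just τ → τ < t) →
                     ∀ c {τ} → proj₁ (next t s d) c ≡ just τ → τ < suc t
    next-topsBelow {t} (tops , inv) (yes top) topsBelow c eq
      with setTop-lookup tops (proj₁ (placement (widen inv) top)) t c
    ... | inj₁ (_ , eq′) with trans (sym eq) eq′
    ...   | refl = n<1+n t
    next-topsBelow (tops , inv) (yes top) topsBelow c eq | inj₂ eq′ =
      m<n⇒m<1+n (topsBelow c (trans (sym eq′) eq))
    next-topsBelow (tops , inv) (no _) topsBelow c eq = m<n⇒m<1+n (topsBelow c eq)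

    topsAt-below : ∀ t c {τ} → topsAt t c ≡ just τ → τ < t
    topsAt-below zero c ()
    topsAt-below (suc t) = next-topsBelow (state t) (topOfWideAntichain? t) (topsAt-below t)

    chosen-below : ∀ {t} (s : State t) d → TopOfWideAntichain t → Below (proj₁ s (chosen t s d)) t
    chosen-below (tops , inv) (yes top) _ = proj₁ (proj₂ (placement (widen inv) top))
    chosen-below _ (no ¬top) top = ⊥-elim (¬top top)

    next-chosen : ∀ {t} (s : State t) d → TopOfWideAntichain t → proj₁ (next t s d) (chosen t s d) ≡ just t
    next-chosen (tops , inv) (yes top) _ = updateAt-updates (proj₁ (placement (widen inv) top)) tops
    next-chosen _ (no ¬top) top = ⊥-elim (¬top top)

    next-grows : ∀ {t} (s : State t) d {c τ} → proj₁ s c ≡ just τ →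
                 ∃ λ τ′ → proj₁ (next t s d) c ≡ just τ′ × τ ≼ τ′
    next-grows {t} (tops , inv) (yes top) {c} eq with setTop-lookup tops (proj₁ (placement (widen inv) top)) t c
    ... | inj₁ (refl , eq′) =
      t , eq′ , subst (λ o → Below o t) eq (proj₁ (proj₂ (placement (widen inv) top)))
    ... | inj₂ eq′ = _ , trans eq′ eq , inj₁ refl
    next-grows _ (no _) eq = _ , eq , inj₁ refl

    chain-grows : ∀ t {x} → x < t → TopOfWideAntichain x → ∃ λ τ → topsAt t (colour x) ≡ just τ × x ≼ τ
    chain-grows (suc t) {x} x<1+t x-top with m≤n⇒m<n∨m≡n (≤-pred x<1+t)
    ... | inj₂ refl = x , next-chosen (state t) (topOfWideAntichain? t) x-top , inj₁ refl
    ... | inj₁ x<t with chain-grows t x<t x-top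
    ...   | τ , eq , x≼τ with next-grows (state t) (topOfWideAntichain? t) eq
    ...     | τ′ , eq′ , τ≼τ′ = τ′ , eq′ , ≼-trans x≼τ τ≼τ′

    topCover : ChainCover TopOfWideAntichain (suc w)
    topCover = colour , chains
      where
      chains : ∀ {x y} → TopOfWideAntichain x → TopOfWideAntichain y → x < y →
               colour x ≡ colour y → f x y ≡ zero
      chains {x} {y} x-top y-top x<y same with chain-grows y x<y x-top
      ... | τ , top≡τ , x≼τ = proj₂ (≼-≺-trans x≼τ τ≺y)
        where
        top≡τ′ : topsAt y (colour y) ≡ just τ
        top≡τ′ = trans (cong (topsAt y) (sym same)) top≡τ
        τ≺y : τ ≺ y
        τ≺y with subst (λ o → Below o y) top≡τ′ (chosen-below (state y) (topOfWideAntichain? y) y-top)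
        ... | inj₂ τ≺y = τ≺y
        ... | inj₁ refl = ⊥-elim (<-irrefl refl (topsAt-below y (colour y) top≡τ′))

  chainCover : ∀ w {S} → U.Decidable S → WidthAtMost S w → ChainCover S (suc (suc w) C 2)
  chainCover zero S? width≤ = (λ _ → zero) , λ Sx → ⊥-elim (WidthAtMost0⇒∉ width≤ Sx)
  chainCover (suc w) S? width≤ = ChainCover-inject≤ (suc+[2+n]C2≤[3+n]C2 w)
    (ChainCover-split topOfWideAntichain? topCover (chainCover w residual? WidthAtMost-Residual))
    where open TopLayer S? w width≤

proposition2p5 : (k : ℕ) (f : Coloring2) →
    TransitiveFor f zero →
    ¬ HasHomogeneousOfSize f (suc zero) k →
    Σ (ℕ → Fin (suc k C 2))
      (λ g → ∀ (i : Fin (suc k C 2)) → HomogeneousFor f zero (λ x → g x ≡ i))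
proposition2p5 zero f _ noHomogeneous = ⊥-elim (noHomogeneous ((λ ()) , (λ ()) , λ { _ _ (() , _) }))
proposition2p5 (suc w) f f-transitive noHomogeneous
  with chainCover f f-transitive w (λ _ → yes tt) (¬homogeneous⇒WidthAtMost f f-transitive noHomogeneous)
... | g , g-chains = g , λ i x y gx≡i gy≡i x<y → g-chains tt tt x<y (trans gx≡i (sym gy≡i))
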